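{- Let $k\in\mathbb{N}$ and $n\in\mathbb{N}$. The number of maximal configurations of length $n$ in the $k$-story Flory model equals the number of compositions (ordered partitions) of $n+2k+1$ into parts from $\{k+1,k+2,\dots,2k+1\}$.
   Context: $k$-story Flory model: a configuration of length $n$ is $C=(c_1,\dots,c_n)\in\{0,k\}^n$, where $c_i=k$ means lot $i$ of a $1\times n$ strip carries a $k$-story house and $c_i=0$ means it is empty; set $c_j=0$ for $j\notin\{1,\dots,n\}$ (no obstruction beyond the boundary). A house with $c_i$ stories on lot $i$ blocks sunlight (from its side) to each lot $j$ with $1\le |i-j|\le c_i$ up to height $c_i-|i-j|+1$ stories, i.e.\ story $h$ of the house on lot $j$ is blocked from the west (resp.\ east) if some $i<j$ (resp.\ $i>j$) has $h\le c_i-|i-j|+1$. $C$ is permissible if every story of every house is blocked neither from the east nor from the west (equivalently, any two houses are separated by at least $k$ empty lots). $C$ is maximal if it is permissible and placing a $k$-story house on any empty lot yields a non-permissible configuration. -}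

module Defs where

open import Data.Nat using (ℕ; zero; suc; _+_; _*_; _∸_; _≤_; _<_; _≤?_; _<?_)
open import Data.Nat.Properties using ()
open import Data.Bool using (Bool; true; false; if_then_else_)
open import Data.Bool.Properties using () renaming (_≟_ to _≟B_)
open import Data.Fin using (Fin; toℕ)
open import Data.Fin.Properties using (all?; any?)
open import Data.Vec using (Vec; []; _∷_; lookup; _[_]≔_)
open import Data.List using (List; []; _∷_; map; concatMap; upTo; filter; length)
open import Data.Nat.ListAction using (sum)
open import Data.List.Relation.Unary.All using (All) renaming (all? to allL?)
open import Data.Product using (Σ; ∃; _×_; _,_)
open import Relation.Nullary using (¬_; Dec; yes; no)
open import Relation.Nullary.Decidable using (_×-dec_; ¬?; _→-dec_)
open import Relation.Binary.PropositionalEquality using (_≡_)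
open import Data.Nat using (_≟_)

-- A configuration of length n is a vector C of n booleans:
--   lookup C i = true  means lot i carries a k-story house (c_i = k),
--   lookup C i = false means lot i is empty (c_i = 0).
-- Lots are indexed by Fin n (lot i of the paper is toℕ i + 1; only
-- differences of positions matter).  Lots outside the strip have c = 0
-- and therefore never block anything, so only lots in Fin n are considered.

Config : ℕ → Set
Config n = Vec Bool n

module Flory (k : ℕ) where

  stories : ∀ {n} → Config n → Fin n → ℕ
  stories C i = if lookup C i then k else 0

  BlockedWest : ∀ {n} → Config n → Fin n → ℕ → Set
  BlockedWest {n} C j h =
    Σ (Fin n) λ i → (toℕ i < toℕ j)
      × ((toℕ j ∸ toℕ i) ≤ stories C i)
      × (h ≤ (stories C i ∸ (toℕ j ∸ toℕ i)) + 1)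

  BlockedEast : ∀ {n} → Config n → Fin n → ℕ → Set
  BlockedEast {n} C j h =
    Σ (Fin n) λ i → (toℕ j < toℕ i)
      × ((toℕ i ∸ toℕ j) ≤ stories C i)
      × (h ≤ (stories C i ∸ (toℕ i ∸ toℕ j)) + 1)

  Permissible : ∀ {n} → Config n → Set
  Permissible {n} C =
    (j : Fin n) → lookup C j ≡ true → (s : Fin k) →
      ¬ BlockedWest C j (suc (toℕ s)) × ¬ BlockedEast C j (suc (toℕ s))

  Maximal : ∀ {n} → Config n → Set
  Maximal {n} C =
    Permissible C × ((j : Fin n) → lookup C j ≡ false → ¬ Permissible (C [ j ]≔ true))

  blockedWest? : ∀ {n} (C : Config n) j h → Dec (BlockedWest C j h)
  blockedWest? C j h = any? λ i →
    (toℕ i <? toℕ j) ×-dec ((_ ≤? _) ×-dec (h ≤? _))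

  blockedEast? : ∀ {n} (C : Config n) j h → Dec (BlockedEast C j h)
  blockedEast? C j h = any? λ i →
    (toℕ j <? toℕ i) ×-dec ((_ ≤? _) ×-dec (h ≤? _))

  permissible? : ∀ {n} (C : Config n) → Dec (Permissible C)
  permissible? C = all? λ j → (lookup C j ≟B true) →-dec all? λ s →
    ¬? (blockedWest? C j _) ×-dec ¬? (blockedEast? C j _)

  maximal? : ∀ {n} (C : Config n) → Dec (Maximal C)
  maximal? C = permissible? C ×-dec all? λ j →
    (lookup C j ≟B false) →-dec ¬? (permissible? (C [ j ]≔ true))

allConfigs : (n : ℕ) → List (Config n)
allConfigs zero = [] ∷ []
allConfigs (suc n) = concatMap (λ b → map (b ∷_) (allConfigs n)) (false ∷ true ∷ [])

numMaximal : ℕ → ℕ → ℕ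
numMaximal k n = length (filter (Flory.maximal? k) (allConfigs n))

IsComposition : ℕ → ℕ → List ℕ → Set
IsComposition k m ps = All (λ p → (suc k ≤ p) × (p ≤ 2 * k + 1)) ps × (sum ps ≡ m)

isComposition? : ∀ k m ps → Dec (IsComposition k m ps)
isComposition? k m ps = allL? (λ p → (suc k ≤? p) ×-dec (p ≤? 2 * k + 1)) ps ×-dec (sum ps ≟ m)

listsOf : ℕ → ℕ → List (List ℕ)
listsOf B zero = [] ∷ []
listsOf B (suc L) = concatMap (λ x → map (x ∷_) (listsOf B L)) (upTo B)

-- all lists of length ≤ m with entries ≤ m (each exactly once); every
-- composition of m into positive parts is among them
candidates : ℕ → List (List ℕ)
candidates m = concatMap (listsOf (suc m)) (upTo (suc m))

numCompositions : ℕ → ℕ → ℕ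
numCompositions k m = length (filter (isComposition? k m) (candidates m))

-- A configuration is permissible when its houses are more than k lots apart, and
-- maximal when moreover every vacant lot lies within k lots of a house.  With
-- virtual houses k+1 lots west and k lots east of the strip, this says exactly that
-- consecutive houses are between k+1 and 2k+1 lots apart, and these distances form
-- a composition of n+2k+1.  Both counts therefore satisfy one recursion: reading
-- the configuration lot by lot, and peeling the first part of a composition off
-- one unit at a time.

module Submission where

open import Defs
open import Data.Bool using (Bool; true; false; T; if_then_else_; _∧_)
open import Data.Bool.Properties using (T-∧) renaming (_≟_ to _≟B_)
open import Data.Fin using (Fin; zero; suc; toℕ; fromℕ<)
open import Data.Fin.Properties using (any?; toℕ-injective; toℕ-fromℕ<) renaming (_≟_ to _≟F_)
open import Data.List using (List; []; _∷_; _++_; map; concatMap; length; filter; applyUpTo; upTo)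
open import Data.List.Properties using (length-++; filter-++; filter-none; filter-≐; map-upTo)
open import Data.List.Relation.Unary.All using (_∷_; universal)
open import Data.Nat using (ℕ; zero; suc; _+_; _*_; _∸_; _≤_; _<_; _≤?_; z≤n; s≤s; s≤s⁻¹; z<s; s<s; s<s⁻¹)
open import Data.Nat.ListAction using (sum)
open import Data.Nat.Properties
  using (+-assoc; +-comm; +-identityʳ; +-suc; +-mono-≤; +-monoʳ-≤; +-monoˡ-≤; +-cancelʳ-≤; +-commutativeSemigroup;
         ≤-refl; ≤-trans; <-irrefl; <-cmp; <-≤-trans; ≤-<-trans; <⇒≤; <⇒≱; ≰⇒>; n≮n; n≤1+n; m≤m+n; m≤n+m;
         m+n≤o⇒m≤o; m+n≤o⇒n≤o; m≤n+m∸n; m≤n+o⇒m∸n≤o; m<n⇒0<n∸m; m+[n∸m]≡n; m+n∸m≡n; m∸n≤m; n∸n≡0; ∸-monoʳ-<)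
open import Algebra.Properties.CommutativeSemigroup +-commutativeSemigroup using (interchange)
open import Data.Nat.Tactic.RingSolver using (solve-∀)
open import Data.Product using (∃-syntax; _×_; _,_; proj₁; proj₂)
open import Data.Product.Function.NonDependent.Propositional using (_×-⇔_)
open import Data.Sum using (_⊎_; inj₁; inj₂)
open import Data.Vec using ([]; _∷_; lookup; _[_]≔_)
open import Data.Vec.Properties using (lookup∘update; lookup∘update′)
open import Function using (_∘_; _⇔_; mk⇔; Equivalence)
open import Function.Properties.Equivalence using () renaming (trans to ⇔-trans; sym to ⇔-sym)
open import Relation.Binary.Definitions using (tri<; tri≈; tri>)
open import Relation.Binary.PropositionalEquality
open import Relation.Nullary using (Dec; yes; no; ¬_; does; contradiction)
open import Relation.Nullary.Decidable using (_×-dec_; T?; dec-false)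
open import Relation.Unary using (Pred; Decidable)

open Equivalence using (to; from)

∑ : ℕ → (ℕ → ℕ) → ℕ
∑ zero    f = 0
∑ (suc n) f = f 0 + ∑ n (f ∘ suc)

syntax ∑ n (λ i → e) = ∑[ i < n ] e

∑-cong : ∀ n {f g : ℕ → ℕ} → (∀ {i} → i < n → f i ≡ g i) → ∑ n f ≡ ∑ n g
∑-cong zero    f≡g = refl
∑-cong (suc n) f≡g = cong₂ _+_ (f≡g z<s) (∑-cong n (f≡g ∘ s<s))

∑-zero : ∀ n {f : ℕ → ℕ} → (∀ {i} → i < n → f i ≡ 0) → ∑ n f ≡ 0
∑-zero zero    f≡0 = refl
∑-zero (suc n) f≡0 = cong₂ _+_ (f≡0 z<s) (∑-zero n (f≡0 ∘ s<s))

∑-+ : ∀ m n (f : ℕ → ℕ) → ∑ (m + n) f ≡ ∑ m f + ∑[ i < n ] f (m + i)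
∑-+ zero    n f = refl
∑-+ (suc m) n f = trans (cong (f 0 +_) (∑-+ m n (f ∘ suc))) (sym (+-assoc (f 0) _ _))

∑-snoc : ∀ n (f : ℕ → ℕ) → ∑ (suc n) f ≡ ∑ n f + f n
∑-snoc zero    f = +-identityʳ (f 0)
∑-snoc (suc n) f = trans (cong (f 0 +_) (∑-snoc n (f ∘ suc))) (sym (+-assoc (f 0) _ _))

∑-vanishing : ∀ {m n} {f : ℕ → ℕ} → m ≤ n → (∀ {i} → m ≤ i → f i ≡ 0) → ∑ n f ≡ ∑ m f
∑-vanishing {m} {n} {f} m≤n f≡0 = begin
  ∑ n f                                ≡⟨ cong (λ l → ∑ l f) (m+[n∸m]≡n m≤n) ⟨
  ∑ (m + (n ∸ m)) f                    ≡⟨ ∑-+ m (n ∸ m) f ⟩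
  ∑ m f + ∑[ i < n ∸ m ] f (m + i)     ≡⟨ cong (∑ m f +_) (∑-zero (n ∸ m) (λ _ → f≡0 (m≤m+n m _))) ⟩
  ∑ m f + 0                            ≡⟨ +-identityʳ (∑ m f) ⟩
  ∑ m f                                ∎
  where open ≡-Reasoning

∑-distrib-+ : ∀ n (f g : ℕ → ℕ) → ∑[ i < n ] (f i + g i) ≡ ∑ n f + ∑ n g
∑-distrib-+ zero    f g = refl
∑-distrib-+ (suc n) f g =
  trans (cong (f 0 + g 0 +_) (∑-distrib-+ n (f ∘ suc) (g ∘ suc))) (interchange (f 0) (g 0) _ _)

∑-comm : ∀ m n (f : ℕ → ℕ → ℕ) → ∑[ i < m ] ∑[ j < n ] f i j ≡ ∑[ j < n ] ∑[ i < m ] f i j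
∑-comm zero    n f = sym (∑-zero n (λ _ → refl))
∑-comm (suc m) n f = begin
  ∑[ j < n ] f 0 j + ∑[ i < m ] ∑[ j < n ] f (suc i) j  ≡⟨ cong (∑[ j < n ] f 0 j +_) (∑-comm m n (f ∘ suc)) ⟩
  ∑[ j < n ] f 0 j + ∑[ j < n ] ∑[ i < m ] f (suc i) j  ≡⟨ ∑-distrib-+ n (f 0) _ ⟨
  ∑[ j < n ] (f 0 j + ∑[ i < m ] f (suc i) j)           ∎
  where open ≡-Reasoning

∑-if : ∀ n b (f : ℕ → ℕ) → ∑[ i < n ] (if b then f i else 0) ≡ (if b then ∑ n f else 0)
∑-if n true  f = refl
∑-if n false f = ∑-zero n (λ _ → refl)

sum-map-upTo : ∀ (f : ℕ → ℕ) n → sum (map f (upTo n)) ≡ ∑ n f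
sum-map-upTo f n = trans (cong sum (map-upTo f n)) (sum-applyUpTo f n)
  where
  sum-applyUpTo : ∀ (f : ℕ → ℕ) n → sum (applyUpTo f n) ≡ ∑ n f
  sum-applyUpTo f zero    = refl
  sum-applyUpTo f (suc n) = cong (f 0 +_) (sum-applyUpTo (f ∘ suc) n)

T-does : ∀ {a} {A : Set a} (a? : Dec A) → T (does a?) ⇔ A
T-does (yes a) = mk⇔ (λ _ → a) _
T-does (no ¬a) = mk⇔ (λ ()) ¬a

if-does : ∀ {a} {A : Set a} (a? : Dec A) {v w : ℕ} → (A → w ≡ v) → (¬ A → w ≡ 0) → w ≡ (if does a? then v else 0)
if-does (yes a) w≡v _   = w≡v a
if-does (no ¬a) _   w≡0 = w≡0 ¬a

module _ {a p} {A : Set a} {P : Pred A p} (P? : Decidable P) where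

  count : List A → ℕ
  count xs = length (filter P? xs)

  count-++ : ∀ xs ys → count (xs ++ ys) ≡ count xs + count ys
  count-++ xs ys = trans (cong length (filter-++ P? xs ys)) (length-++ (filter P? xs))

  count-concatMap : ∀ {b} {B : Set b} (f : B → List A) xs →
                    count (concatMap f xs) ≡ sum (map (count ∘ f) xs)
  count-concatMap f []       = refl
  count-concatMap f (x ∷ xs) = trans (count-++ (f x) (concatMap f xs)) (cong (count (f x) +_) (count-concatMap f xs))

  count-none : (∀ x → ¬ P x) → ∀ xs → count xs ≡ 0
  count-none ¬P xs = cong length (filter-none P? (universal ¬P xs))

count-map : ∀ {a b p} {A : Set a} {B : Set b} {P : Pred A p} (P? : Decidable P) (f : B → A) xs →
            count P? (map f xs) ≡ count (P? ∘ f) xs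
count-map P? f []       = refl
count-map P? f (x ∷ xs) with does (P? (f x))
... | true  = cong suc (count-map P? f xs)
... | false = count-map P? f xs

count-cong : ∀ {a p q} {A : Set a} {P : Pred A p} {Q : Pred A q} (P? : Decidable P) (Q? : Decidable Q) →
             (∀ x → P x ⇔ Q x) → ∀ xs → count P? xs ≡ count Q? xs
count-cong P? Q? P⇔Q xs = cong length (filter-≐ P? Q? ((λ {x} → to (P⇔Q x)) , (λ {x} → from (P⇔Q x))) xs)

count-∧ : ∀ {a} {A : Set a} b (f : A → Bool) xs →
          count (λ x → T? (b ∧ f x)) xs ≡ (if b then count (T? ∘ f) xs else 0)
count-∧ true  f xs = refl
count-∧ false f xs = count-none (λ _ → T? false) (λ _ ()) xs

count-allConfigs-suc : ∀ {p} r {P : Pred (Config (suc r)) p} (P? : Decidable P) →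
                       count P? (allConfigs (suc r)) ≡
                       count (P? ∘ (false ∷_)) (allConfigs r) + count (P? ∘ (true ∷_)) (allConfigs r)
count-allConfigs-suc r P? = begin
  count P? (allConfigs (suc r))
    ≡⟨ count-concatMap P? (λ b → map (b ∷_) (allConfigs r)) (false ∷ true ∷ []) ⟩
  count P? (map (false ∷_) (allConfigs r)) + (count P? (map (true ∷_) (allConfigs r)) + 0)
    ≡⟨ cong₂ (λ x y → x + (y + 0)) (count-map P? (false ∷_) (allConfigs r))
                                   (count-map P? (true ∷_) (allConfigs r)) ⟩
  count (P? ∘ (false ∷_)) (allConfigs r) + (count (P? ∘ (true ∷_)) (allConfigs r) + 0)
    ≡⟨ cong (count (P? ∘ (false ∷_)) (allConfigs r) +_) (+-identityʳ _) ⟩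
  count (P? ∘ (false ∷_)) (allConfigs r) + count (P? ∘ (true ∷_)) (allConfigs r) ∎
  where open ≡-Reasoning

module _ (k : ℕ) where

  open Flory k

  Occupied Vacant : ∀ {n} → Config n → Fin n → Set
  Occupied C i = lookup C i ≡ true
  Vacant   C i = lookup C i ≡ false

  Spaced : ∀ {n} → Config n → Set
  Spaced C = ∀ {i j} → Occupied C i → Occupied C j → toℕ i < toℕ j → toℕ i + k < toℕ j

  Near : ℕ → ℕ → Set
  Near a b = a ≤ b + k × b ≤ a + k

  near? : ∀ a b → Dec (Near a b)
  near? a b = (a ≤? b + k) ×-dec (b ≤? a + k)

  Covered : ∀ {n} → Config n → Fin n → Set
  Covered C j = ∃[ i ] Occupied C i × Near (toℕ i) (toℕ j)

  covered? : ∀ {n} (C : Config n) j → Dec (Covered C j)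
  covered? C j = any? λ i → (lookup C i ≟B true) ×-dec near? (toℕ i) (toℕ j)

  Dominated : ∀ {n} → Config n → Set
  Dominated C = ∀ {j} → Vacant C j → Covered C j

  within-stories⇒occupied : ∀ b {d} → 0 < d → d ≤ (if b then k else 0) → b ≡ true × d ≤ k
  within-stories⇒occupied true  _   d≤k = refl , d≤k
  within-stories⇒occupied false 0<d d≤0 = contradiction d≤0 (<⇒≱ 0<d)

  spaced⇒permissible : ∀ {n} (C : Config n) → Spaced C → Permissible C
  spaced⇒permissible C spaced j Cj _ = unblocked-west , unblocked-east
    where
    unblocked-west : ¬ BlockedWest C j _
    unblocked-west (i , i<j , reach , _) with within-stories⇒occupied (lookup C i) (m<n⇒0<n∸m i<j) reach
    ... | Ci , j∸i≤k = <⇒≱ (spaced Ci Cj i<j) (≤-trans (m≤n+m∸n (toℕ j) (toℕ i)) (+-monoʳ-≤ (toℕ i) j∸i≤k))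
    unblocked-east : ¬ BlockedEast C j _
    unblocked-east (i , j<i , reach , _) with within-stories⇒occupied (lookup C i) (m<n⇒0<n∸m j<i) reach
    ... | Ci , i∸j≤k = <⇒≱ (spaced Cj Ci j<i) (≤-trans (m≤n+m∸n (toℕ i) (toℕ j)) (+-monoʳ-≤ (toℕ j) i∸j≤k))

  -- The lowest story of the house on lot j is blocked by any house at distance at most k.
  permissible⇒spaced : 1 ≤ k → ∀ {n} (C : Config n) → Permissible C → Spaced C
  permissible⇒spaced 1≤k C permissible {i} {j} Ci Cj i<j =
    ≰⇒> λ j≤i+k → proj₁ (permissible j Cj ground) (i , i<j , reach j≤i+k , lowest)
    where
    ground : Fin k
    ground = fromℕ< 1≤k
    reach : toℕ j ≤ toℕ i + k → toℕ j ∸ toℕ i ≤ stories C i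
    reach j≤i+k = subst (λ b → toℕ j ∸ toℕ i ≤ (if b then k else 0)) (sym Ci) (m≤n+o⇒m∸n≤o (toℕ j) (toℕ i) j≤i+k)
    lowest : suc (toℕ ground) ≤ stories C i ∸ (toℕ j ∸ toℕ i) + 1
    lowest rewrite toℕ-fromℕ< 1≤k = m≤n+m 1 _

  spaced⇒¬near : ∀ {n} (C : Config n) → Spaced C →
                 ∀ {i j} → Occupied C i → Occupied C j → i ≢ j → ¬ Near (toℕ i) (toℕ j)
  spaced⇒¬near C spaced {i} {j} Ci Cj i≢j (i≤j+k , j≤i+k) with <-cmp (toℕ i) (toℕ j)
  ... | tri< i<j _ _ = <⇒≱ (spaced Ci Cj i<j) j≤i+k
  ... | tri≈ _ i≡j _ = i≢j (toℕ-injective i≡j)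
  ... | tri> _ _ j<i = <⇒≱ (spaced Cj Ci j<i) i≤j+k

  occupied-before-insert : ∀ {n} (C : Config n) {i j} → i ≢ j → Occupied (C [ j ]≔ true) i → Occupied C i
  occupied-before-insert C i≢j Ci = trans (sym (lookup∘update′ i≢j C true)) Ci

  spaced-insert : ∀ {n} (C : Config n) {j} → Spaced C → ¬ Covered C j → Spaced (C [ j ]≔ true)
  spaced-insert C {j} spaced uncovered {a} {b} Ca Cb a<b with a ≟F j | b ≟F j
  ... | yes refl | yes refl = contradiction a<b (<-irrefl refl)
  ... | yes refl | no b≢j   = ≰⇒> λ b≤j+k →
          uncovered (b , occupied-before-insert C b≢j Cb , b≤j+k , ≤-trans (<⇒≤ a<b) (m≤m+n _ k))
  ... | no a≢j   | yes refl = ≰⇒> λ j≤a+k →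
          uncovered (a , occupied-before-insert C a≢j Ca , ≤-trans (<⇒≤ a<b) (m≤m+n _ k) , j≤a+k)
  ... | no a≢j   | no b≢j   = spaced (occupied-before-insert C a≢j Ca) (occupied-before-insert C b≢j Cb) a<b

  covered⇒¬spaced-insert : ∀ {n} (C : Config n) {j} → Vacant C j → Covered C j → ¬ Spaced (C [ j ]≔ true)
  covered⇒¬spaced-insert C {j} Cj (i , Ci , near) spaced =
    spaced⇒¬near (C [ j ]≔ true) spaced (trans (lookup∘update′ i≢j C true) Ci) (lookup∘update j C true) i≢j near
    where
    i≢j : i ≢ j
    i≢j refl with trans (sym Ci) Cj
    ... | ()

  maximal⇔spaced×dominated : 1 ≤ k → ∀ {n} (C : Config n) → Maximal C ⇔ (Spaced C × Dominated C)
  maximal⇔spaced×dominated 1≤k C = mk⇔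
    (λ (permissible , saturated) → spaced permissible , dominated permissible saturated)
    (λ (sp , dom) → spaced⇒permissible C sp ,
                    λ j Cj → covered⇒¬spaced-insert C Cj (dom Cj) ∘ permissible⇒spaced 1≤k (C [ j ]≔ true))
    where
    spaced : Permissible C → Spaced C
    spaced = permissible⇒spaced 1≤k C
    dominated : Permissible C → (∀ j → Vacant C j → ¬ Permissible (C [ j ]≔ true)) → Dominated C
    dominated permissible saturated {j} Cj with covered? C j
    ... | yes covered  = covered
    ... | no uncovered = contradiction (spaced⇒permissible (C [ j ]≔ true) (spaced-insert C (spaced permissible) uncovered))
                                       (saturated j Cj)

  Part : ℕ → Set
  Part x = suc k ≤ x × x ≤ 2 * k + 1

  part? : ∀ x → Dec (Part x)
  part? x = (suc k ≤? x) ×-dec (x ≤? 2 * k + 1)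

  isPart : ℕ → Bool
  isPart x = does (part? x)

  part-suc⇔ : ∀ {x} → Part (suc x) ⇔ (k ≤ x × x ≤ k + k)
  part-suc⇔ {x} = mk⇔ (λ (k<x , x≤2k) → s≤s⁻¹ k<x , s≤s⁻¹ (subst (suc x ≤_) 2k+1≡1+k+k x≤2k))
                      (λ (k≤x , x≤k+k) → s≤s k≤x , subst (suc x ≤_) (sym 2k+1≡1+k+k) (s≤s x≤k+k))
    where
    2k+1≡1+k+k : 2 * k + 1 ≡ suc (k + k)
    2k+1≡1+k+k = trans (+-comm (2 * k) 1) (cong (λ m → suc (k + m)) (+-identityʳ k))

  part-+k⇔ : ∀ {g} → Part (suc g + k) ⇔ g ≤ k
  part-+k⇔ {g} = ⇔-trans part-suc⇔ (mk⇔ (λ (_ , g+k≤k+k) → +-cancelʳ-≤ k g k g+k≤k+k)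
                                        (λ g≤k → m≤n+m k g , +-monoˡ-≤ k g≤k))

  -- g counts the vacant lots since the last house, where virtual houses stand
  -- k+1 lots west and k lots east of the strip.
  accepts : ∀ {n} → ℕ → Config n → Bool
  accepts g []          = isPart (suc g + k)
  accepts g (false ∷ C) = accepts (suc g) C
  accepts g (true ∷ C)  = isPart (suc g) ∧ accepts 0 C

  T-isPart : ∀ x → T (isPart x) ⇔ Part x
  T-isPart x = T-does (part? x)

  FarFrom : ∀ {n} → ℕ → Config n → Set
  FarFrom g C = ∀ {i} → Occupied C i → k < suc g + toℕ i

  spaced-∷ : ∀ {n} b (C : Config n) → Spaced (b ∷ C) ⇔ (Spaced C × (b ≡ true → FarFrom 0 C))
  spaced-∷ b C = mk⇔ split join
    where
    split : Spaced (b ∷ C) → Spaced C × (b ≡ true → FarFrom 0 C)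
    split sp = (λ {i} {j} Ci Cj i<j → s<s⁻¹ (sp {suc i} {suc j} Ci Cj (s<s i<j))) ,
               (λ b≡true {i} Ci → sp {zero} {suc i} b≡true Ci z<s)
    join : Spaced C × (b ≡ true → FarFrom 0 C) → Spaced (b ∷ C)
    join (sp , far) {zero}  {suc j} b≡true Cj _   = far b≡true Cj
    join (sp , far) {suc i} {suc j} Ci     Cj i<j = s<s (sp Ci Cj (s<s⁻¹ i<j))

  covered-lift : ∀ {n} {C : Config n} {j} b → Covered C j → Covered (b ∷ C) (suc j)
  covered-lift b (i , Ci , i≤j+k , j≤i+k) = suc i , Ci , s≤s i≤j+k , s≤s j≤i+k

  covered-by-head : ∀ {n} {C : Config n} {j : Fin n} → suc (toℕ j) ≤ k → Covered (true ∷ C) (suc j)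
  covered-by-head 1+j≤k = zero , refl , z≤n , 1+j≤k

  covered-∷⁻ : ∀ {n} {C : Config n} {j} b →
               Covered (b ∷ C) (suc j) → Covered C j ⊎ (b ≡ true × suc (toℕ j) ≤ k)
  covered-∷⁻ b (zero  , b≡true , _ , 1+j≤k)               = inj₂ (b≡true , 1+j≤k)
  covered-∷⁻ b (suc i , Ci , s≤s i≤j+k , s≤s j≤i+k) = inj₁ (i , Ci , i≤j+k , j≤i+k)

  -- What maximality demands of the rest C of a configuration after a house and
  -- g vacant lots; those of the g lots farther than k from the house must be
  -- covered by a house of C.
  record MaximalAfter {n} (g : ℕ) (C : Config n) : Set where
    field
      spaced    : Spaced C
      far       : FarFrom g C
      dominated : ∀ {j} → Vacant C j → Covered C j ⊎ suc g + toℕ j ≤ k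
      reached   : g ≤ k ⊎ ∃[ i ] Occupied C i × toℕ i + g ≤ k + k

  spaced×dominated⇔maximalAfter : ∀ {n} (C : Config n) → (Spaced C × Dominated C) ⇔ MaximalAfter k C
  spaced×dominated⇔maximalAfter C = mk⇔ maximalAfter spaced×dominated
    where
    maximalAfter : Spaced C × Dominated C → MaximalAfter k C
    maximalAfter (spaced , dominated) = record
      { spaced    = spaced
      ; far       = λ {i} _ → s≤s (m≤m+n k (toℕ i))
      ; dominated = inj₁ ∘ dominated
      ; reached   = inj₁ ≤-refl
      }
    spaced×dominated : MaximalAfter k C → Spaced C × Dominated C
    spaced×dominated M = spaced , λ Cj → covered (dominated Cj)
      where
      open MaximalAfter M
      covered : ∀ {j} → Covered C j ⊎ suc k + toℕ j ≤ k → Covered C j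
      covered (inj₁ cov)     = cov
      covered (inj₂ 1+k+j≤k) = contradiction (m+n≤o⇒m≤o (suc k) 1+k+j≤k) (n≮n k)

  maximalAfter-[] : ∀ {g} → MaximalAfter g [] ⇔ g ≤ k
  maximalAfter-[] = mk⇔ reached (λ g≤k → record
    { spaced = λ { {()} } ; far = λ { {()} } ; dominated = λ { {()} } ; reached = inj₁ g≤k })
    where
    reached : ∀ {g} → MaximalAfter g [] → g ≤ k
    reached M with MaximalAfter.reached M
    ... | inj₁ g≤k = g≤k

  maximalAfter-false : ∀ {n g} (C : Config n) → MaximalAfter g (false ∷ C) ⇔ MaximalAfter (suc g) C
  maximalAfter-false {g = g} C = mk⇔ shift unshift
    where
    shift : MaximalAfter g (false ∷ C) → MaximalAfter (suc g) C
    shift M = record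
      { spaced    = proj₁ (to (spaced-∷ false C) spaced)
      ; far       = λ {i} Ci → subst (k <_) (+-suc (suc g) (toℕ i)) (far {suc i} Ci)
      ; dominated = λ {j} Cj → dominated-tail (dominated {suc j} Cj)
      ; reached   = reached-tail reached (dominated {zero} refl)
      }
      where
      open MaximalAfter M
      dominated-tail : ∀ {j} → Covered (false ∷ C) (suc j) ⊎ suc g + suc (toℕ j) ≤ k →
                       Covered C j ⊎ suc (suc g) + toℕ j ≤ k
      dominated-tail (inj₁ cov) with covered-∷⁻ false cov
      ... | inj₁ cov′ = inj₁ cov′
      dominated-tail (inj₂ le) = inj₂ (subst (_≤ k) (+-suc (suc g) _) le)
      reached-tail : g ≤ k ⊎ ∃[ i ] Occupied (false ∷ C) i × toℕ i + g ≤ k + k →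
                     Covered (false ∷ C) zero ⊎ suc g + 0 ≤ k →
                     suc g ≤ k ⊎ ∃[ i ] Occupied C i × toℕ i + suc g ≤ k + k
      reached-tail (inj₂ (suc i , Ci , 1+i+g≤k+k)) _ = inj₂ (i , Ci , subst (_≤ k + k) (sym (+-suc (toℕ i) g)) 1+i+g≤k+k)
      reached-tail (inj₁ g≤k) (inj₁ (suc i , Ci , 1+i≤k , _)) =
        inj₂ (i , Ci , subst (_≤ k + k) (sym (+-suc (toℕ i) g)) (+-mono-≤ 1+i≤k g≤k))
      reached-tail (inj₁ _) (inj₂ 1+g+0≤k) = inj₁ (subst (_≤ k) (+-identityʳ (suc g)) 1+g+0≤k)
    unshift : MaximalAfter (suc g) C → MaximalAfter g (false ∷ C)
    unshift M = record
      { spaced    = from (spaced-∷ false C) (spaced , λ ())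
      ; far       = λ { {suc i} Ci → subst (k <_) (sym (+-suc (suc g) (toℕ i))) (far Ci) }
      ; dominated = dominated-∷
      ; reached   = reached-∷ reached
      }
      where
      open MaximalAfter M
      reached-∷ : suc g ≤ k ⊎ ∃[ i ] Occupied C i × toℕ i + suc g ≤ k + k →
                  g ≤ k ⊎ ∃[ i ] Occupied (false ∷ C) i × toℕ i + g ≤ k + k
      reached-∷ (inj₁ 1+g≤k)             = inj₁ (≤-trans (n≤1+n g) 1+g≤k)
      reached-∷ (inj₂ (i , Ci , i+1+g≤k+k)) = inj₂ (suc i , Ci , subst (_≤ k + k) (+-suc (toℕ i) g) i+1+g≤k+k)
      -- If the house g lots back does not reach lot 0, the house of C reaching
      -- beyond it does.
      first-dominated : Covered (false ∷ C) zero ⊎ suc g + 0 ≤ k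
      first-dominated with suc g ≤? k | reached
      ... | yes 1+g≤k | _ = inj₂ (subst (_≤ k) (sym (+-identityʳ (suc g))) 1+g≤k)
      ... | no 1+g≰k | inj₁ 1+g≤k = contradiction 1+g≤k 1+g≰k
      ... | no 1+g≰k | inj₂ (i , Ci , i+1+g≤k+k) = inj₁ (suc i , Ci , 1+i≤k , z≤n)
        where
        1+i≤k : suc (toℕ i) ≤ k
        1+i≤k = +-cancelʳ-≤ k (suc (toℕ i)) k (≤-trans (+-monoʳ-≤ (suc (toℕ i)) (s≤s⁻¹ (≰⇒> 1+g≰k)))
                                                        (subst (_≤ k + k) (+-suc (toℕ i) g) i+1+g≤k+k))
      dominated-∷ : ∀ {j} → Vacant (false ∷ C) j → Covered (false ∷ C) j ⊎ suc g + toℕ j ≤ k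
      dominated-∷ {zero}  _ = first-dominated
      dominated-∷ {suc j} Cj with dominated Cj
      ... | inj₁ cov = inj₁ (covered-lift false cov)
      ... | inj₂ le  = inj₂ (subst (_≤ k) (sym (+-suc (suc g) (toℕ j))) le)

  maximalAfter-true : ∀ {n g} (C : Config n) → MaximalAfter g (true ∷ C) ⇔ (Part (suc g) × MaximalAfter 0 C)
  maximalAfter-true {g = g} C = mk⇔ split join
    where
    split : MaximalAfter g (true ∷ C) → Part (suc g) × MaximalAfter 0 C
    split M = from part-suc⇔ (k≤g , g≤k+k) , record
      { spaced    = proj₁ spaced-tail×far
      ; far       = proj₂ spaced-tail×far refl
      ; dominated = λ {j} Cj → dominated-tail (dominated {suc j} Cj)
      ; reached   = inj₁ z≤n
      }
      where
      open MaximalAfter M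
      spaced-tail×far = to (spaced-∷ true C) spaced
      k≤g : k ≤ g
      k≤g = s≤s⁻¹ (subst (k <_) (+-identityʳ (suc g)) (far {zero} refl))
      g≤k+k : g ≤ k + k
      g≤k+k with reached
      ... | inj₁ g≤k = ≤-trans g≤k (m≤m+n k k)
      ... | inj₂ (i , _ , i+g≤k+k) = m+n≤o⇒n≤o (toℕ i) i+g≤k+k
      dominated-tail : ∀ {j} → Covered (true ∷ C) (suc j) ⊎ suc g + suc (toℕ j) ≤ k →
                       Covered C j ⊎ suc (toℕ j) ≤ k
      dominated-tail (inj₁ cov) with covered-∷⁻ true cov
      ... | inj₁ cov′         = inj₁ cov′
      ... | inj₂ (_ , 1+j≤k) = inj₂ 1+j≤k
      dominated-tail (inj₂ le) = inj₂ (≤-trans (m≤n+m _ (suc g)) le)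
    join : Part (suc g) × MaximalAfter 0 C → MaximalAfter g (true ∷ C)
    join (part , M) = record
      { spaced    = from (spaced-∷ true C) (spaced , λ _ → far)
      ; far       = far-∷
      ; dominated = dominated-∷
      ; reached   = inj₂ (zero , refl , g≤k+k)
      }
      where
      open MaximalAfter M
      k≤g = proj₁ (to part-suc⇔ part)
      g≤k+k = proj₂ (to part-suc⇔ part)
      far-∷ : FarFrom g (true ∷ C)
      far-∷ {zero}  _ = subst (k <_) (sym (+-identityʳ (suc g))) (s≤s k≤g)
      far-∷ {suc i} _ = ≤-trans (s≤s k≤g) (m≤m+n (suc g) _)
      dominated-∷ : ∀ {j} → Vacant (true ∷ C) j → Covered (true ∷ C) j ⊎ suc g + toℕ j ≤ k
      dominated-∷ {suc j} Cj with dominated Cj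
      ... | inj₁ cov   = inj₁ (covered-lift true cov)
      ... | inj₂ 1+j≤k = inj₁ (covered-by-head 1+j≤k)

  accepts⇔maximalAfter : ∀ {n} g (C : Config n) → T (accepts g C) ⇔ MaximalAfter g C
  accepts⇔maximalAfter g [] = ⇔-trans (T-isPart (suc g + k)) (⇔-trans part-+k⇔ (⇔-sym maximalAfter-[]))
  accepts⇔maximalAfter g (false ∷ C) = ⇔-trans (accepts⇔maximalAfter (suc g) C) (⇔-sym (maximalAfter-false C))
  accepts⇔maximalAfter g (true ∷ C) =
    ⇔-trans T-∧ (⇔-trans (T-isPart (suc g) ×-⇔ accepts⇔maximalAfter 0 C) (⇔-sym (maximalAfter-true C)))

  maximal⇔accepts : 1 ≤ k → ∀ {n} (C : Config n) → Maximal C ⇔ T (accepts k C)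
  maximal⇔accepts 1≤k C = ⇔-trans (maximal⇔spaced×dominated 1≤k C)
                            (⇔-trans (spaced×dominated⇔maximalAfter C) (⇔-sym (accepts⇔maximalAfter k C)))

  #accepted : ℕ → ℕ → ℕ
  #accepted g r = count (λ C → T? (accepts g C)) (allConfigs r)

  #accepted-zero : ∀ g → #accepted g 0 ≡ (if isPart (suc g + k) then 1 else 0)
  #accepted-zero g with isPart (suc g + k)
  ... | true  = refl
  ... | false = refl

  #accepted-suc : ∀ g r → #accepted g (suc r) ≡ #accepted (suc g) r + (if isPart (suc g) then #accepted 0 r else 0)
  #accepted-suc g r = trans (count-allConfigs-suc r (λ C → T? (accepts g C)))
                            (cong (#accepted (suc g) r +_) (count-∧ (isPart (suc g)) (accepts 0) (allConfigs r)))

  #compositionsOfLength : ℕ → ℕ → ℕ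
  #compositionsOfLength zero    zero    = 1
  #compositionsOfLength zero    (suc m) = 0
  #compositionsOfLength (suc L) m       = ∑[ x < suc m ] (if isPart x then #compositionsOfLength L (m ∸ x) else 0)

  #compositions : ℕ → ℕ
  #compositions m = ∑[ L < suc m ] #compositionsOfLength L m

  -- The compositions of suc g + m whose first part exceeds g.
  #compositionsAbove : ℕ → ℕ → ℕ
  #compositionsAbove g m = ∑[ i < suc m ] (if isPart (suc g + i) then #compositions (m ∸ i) else 0)

  isComposition-∷ : ∀ {m x xs} → Part x → x ≤ m → IsComposition k m (x ∷ xs) ⇔ IsComposition k (m ∸ x) xs
  isComposition-∷ {m} {x} {xs} part x≤m = mk⇔
    (λ { (_ ∷ parts , x+Σ≡m) → parts , trans (sym (m+n∸m≡n x (sum xs))) (cong (_∸ x) x+Σ≡m) })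
    (λ (parts , Σ≡m∸x) → part ∷ parts , trans (cong (x +_) Σ≡m∸x) (m+[n∸m]≡n x≤m))

  count-compositions-∷ : ∀ {m x} ys → x ≤ m →
    count (isComposition? k m) (map (x ∷_) ys) ≡ (if isPart x then count (isComposition? k (m ∸ x)) ys else 0)
  count-compositions-∷ {m} {x} ys x≤m = trans (count-map (isComposition? k m) (x ∷_) ys) (if-does (part? x)
    (λ part → count-cong _ (isComposition? k (m ∸ x)) (λ _ → isComposition-∷ part x≤m) ys)
    (λ ¬part → count-none _ (λ { _ (part ∷ _ , _) → ¬part part }) ys))

  count-compositions-∷-large : ∀ {m x} ys → m < x → count (isComposition? k m) (map (x ∷_) ys) ≡ 0
  count-compositions-∷-large {m} {x} ys m<x = trans (count-map (isComposition? k m) (x ∷_) ys)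
    (count-none _ (λ xs (_ , x+Σ≡m) → <⇒≱ m<x (subst (x ≤_) x+Σ≡m (m≤m+n x (sum xs)))) ys)

  count-listsOf : ∀ B L m → m < B → count (isComposition? k m) (listsOf B L) ≡ #compositionsOfLength L m
  count-listsOf B zero    zero    _   = refl
  count-listsOf B zero    (suc m) _   = refl
  count-listsOf B (suc L) m       m<B = begin
    count (isComposition? k m) (listsOf B (suc L))
      ≡⟨ count-concatMap (isComposition? k m) (λ x → map (x ∷_) (listsOf B L)) (upTo B) ⟩
    sum (map (λ x → count (isComposition? k m) (map (x ∷_) (listsOf B L))) (upTo B))
      ≡⟨ sum-map-upTo _ B ⟩
    ∑[ x < B ] count (isComposition? k m) (map (x ∷_) (listsOf B L))
      ≡⟨ ∑-vanishing m<B (λ m<x → count-compositions-∷-large (listsOf B L) m<x) ⟩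
    ∑[ x < suc m ] count (isComposition? k m) (map (x ∷_) (listsOf B L))
      ≡⟨ ∑-cong (suc m) (λ x<1+m → count-compositions-∷ (listsOf B L) (s≤s⁻¹ x<1+m)) ⟩
    ∑[ x < suc m ] (if isPart x then count (isComposition? k (m ∸ x)) (listsOf B L) else 0)
      ≡⟨ ∑-cong (suc m) (λ {x} _ → cong (λ c → if isPart x then c else 0)
                                        (count-listsOf B L (m ∸ x) (≤-<-trans (m∸n≤m m x) m<B))) ⟩
    #compositionsOfLength (suc L) m ∎
    where open ≡-Reasoning

  numCompositions≡#compositions : ∀ m → numCompositions k m ≡ #compositions m
  numCompositions≡#compositions m = begin
    numCompositions k m
      ≡⟨ count-concatMap (isComposition? k m) (listsOf (suc m)) (upTo (suc m)) ⟩
    sum (map (count (isComposition? k m) ∘ listsOf (suc m)) (upTo (suc m)))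
      ≡⟨ sum-map-upTo _ (suc m) ⟩
    ∑[ L < suc m ] count (isComposition? k m) (listsOf (suc m) L)
      ≡⟨ ∑-cong (suc m) (λ {L} _ → count-listsOf (suc m) L m ≤-refl) ⟩
    #compositions m ∎
    where open ≡-Reasoning

  isPart-≤ : ∀ {x} → x ≤ k → isPart x ≡ false
  isPart-≤ x≤k = dec-false (part? _) (λ (k<x , _) → <⇒≱ k<x x≤k)

  #compositionsOfLength-vanishes : ∀ L m → m < L → #compositionsOfLength L m ≡ 0
  #compositionsOfLength-vanishes (suc L) m m<1+L = ∑-zero (suc m) λ {x} x<1+m →
    sym (if-does (part? x) (λ (k<x , _) → sym (#compositionsOfLength-vanishes L (m ∸ x) (m∸x<L k<x x<1+m)))
                           (λ _ → refl))
    where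
    m∸x<L : ∀ {x} → suc k ≤ x → x < suc m → m ∸ x < L
    m∸x<L k<x x<1+m = <-≤-trans (∸-monoʳ-< (≤-trans (s≤s z≤n) k<x) (s≤s⁻¹ x<1+m)) (s≤s⁻¹ m<1+L)

  -- The left-hand side unfolds to the first line: no composition of suc m has
  -- no parts, and 0 is not a part.
  #compositions-suc : ∀ m → #compositions (suc m) ≡ #compositionsAbove 0 m
  #compositions-suc m = begin
    ∑[ L < suc m ] ∑[ i < suc m ] (if isPart (suc i) then #compositionsOfLength L (m ∸ i) else 0)
      ≡⟨ ∑-comm (suc m) (suc m) (λ L i → if isPart (suc i) then #compositionsOfLength L (m ∸ i) else 0) ⟩
    ∑[ i < suc m ] ∑[ L < suc m ] (if isPart (suc i) then #compositionsOfLength L (m ∸ i) else 0)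
      ≡⟨ ∑-cong (suc m) (λ {i} _ → ∑-if (suc m) (isPart (suc i)) (λ L → #compositionsOfLength L (m ∸ i))) ⟩
    ∑[ i < suc m ] (if isPart (suc i) then ∑[ L < suc m ] #compositionsOfLength L (m ∸ i) else 0)
      ≡⟨ ∑-cong (suc m) (λ {i} _ → cong (λ c → if isPart (suc i) then c else 0)
                                        (∑-vanishing (s≤s (m∸n≤m m i)) (#compositionsOfLength-vanishes _ (m ∸ i)))) ⟩
    #compositionsAbove 0 m ∎
    where open ≡-Reasoning

  #compositionsAbove-suc : ∀ g m → #compositionsAbove g (suc m) ≡
                           (if isPart (suc g) then #compositions (suc m) else 0) + #compositionsAbove (suc g) m
  #compositionsAbove-suc g m =
    cong₂ _+_ (cong (λ x → if isPart x then #compositions (suc m) else 0) (+-identityʳ (suc g)))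
              (∑-cong (suc m) (λ {i} _ → cong (λ x → if isPart x then #compositions (m ∸ i) else 0) (+-suc (suc g) i)))

  #compositions-≤ : ∀ {m} → 0 < m → m ≤ k → #compositions m ≡ 0
  #compositions-≤ {suc m} _ 1+m≤k = trans (#compositions-suc m) (∑-zero (suc m) (λ {i} i<1+m →
    cong (λ b → if b then #compositions (m ∸ i) else 0) (isPart-≤ (≤-trans i<1+m 1+m≤k))))

  #compositionsAbove-k : ∀ g → #compositionsAbove g k ≡ (if isPart (suc g + k) then 1 else 0)
  #compositionsAbove-k g = trans (∑-snoc k _) (cong₂ _+_
    (∑-zero k (λ {i} i<k → if-0 (isPart (suc g + i)) (#compositions-≤ (m<n⇒0<n∸m i<k) (m∸n≤m k i))))
    (cong (λ j → if isPart (suc g + k) then #compositions j else 0) (n∸n≡0 k)))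
    where
    if-0 : ∀ b {v} → v ≡ 0 → (if b then v else 0) ≡ 0
    if-0 true  v≡0 = v≡0
    if-0 false _   = refl

  #compositionsAbove-skip : ∀ j m → j ≤ k → #compositionsAbove 0 (j + m) ≡ #compositionsAbove j m
  #compositionsAbove-skip zero    m _     = refl
  #compositionsAbove-skip (suc j) m 1+j≤k = begin
    #compositionsAbove 0 (suc j + m)
      ≡⟨ cong (#compositionsAbove 0) (+-suc j m) ⟨
    #compositionsAbove 0 (j + suc m)
      ≡⟨ #compositionsAbove-skip j (suc m) (≤-trans (n≤1+n j) 1+j≤k) ⟩
    #compositionsAbove j (suc m)
      ≡⟨ #compositionsAbove-suc j m ⟩
    (if isPart (suc j) then #compositions (suc m) else 0) + #compositionsAbove (suc j) m
      ≡⟨ cong (λ b → (if b then #compositions (suc m) else 0) + #compositionsAbove (suc j) m) (isPart-≤ 1+j≤k) ⟩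
    #compositionsAbove (suc j) m ∎
    where open ≡-Reasoning

  #accepted≡#compositionsAbove : ∀ g r → #accepted g r ≡ #compositionsAbove g (r + k)
  #accepted≡#compositionsAbove g zero    = trans (#accepted-zero g) (sym (#compositionsAbove-k g))
  #accepted≡#compositionsAbove g (suc r) = begin
    #accepted g (suc r)
      ≡⟨ #accepted-suc g r ⟩
    #accepted (suc g) r + (if isPart (suc g) then #accepted 0 r else 0)
      ≡⟨ cong₂ (λ a c → a + (if isPart (suc g) then c else 0))
               (#accepted≡#compositionsAbove (suc g) r)
               (trans (#accepted≡#compositionsAbove 0 r) (sym (#compositions-suc (r + k)))) ⟩
    #compositionsAbove (suc g) (r + k) + (if isPart (suc g) then #compositions (suc (r + k)) else 0)
      ≡⟨ +-comm (#compositionsAbove (suc g) (r + k)) _ ⟩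
    (if isPart (suc g) then #compositions (suc (r + k)) else 0) + #compositionsAbove (suc g) (r + k)
      ≡⟨ #compositionsAbove-suc g (r + k) ⟨
    #compositionsAbove g (suc r + k) ∎
    where open ≡-Reasoning

proposition3p3 : (k n : ℕ) → 1 ≤ k → numMaximal k n ≡ numCompositions k (n + 2 * k + 1)
proposition3p3 k n 1≤k = begin
  numMaximal k n
    ≡⟨ count-cong (Flory.maximal? k) (λ C → T? (accepts k k C)) (maximal⇔accepts k 1≤k) (allConfigs n) ⟩
  #accepted k k n
    ≡⟨ #accepted≡#compositionsAbove k k n ⟩
  #compositionsAbove k k (n + k)
    ≡⟨ #compositionsAbove-skip k k (n + k) ≤-refl ⟨
  #compositionsAbove k 0 (k + (n + k))
    ≡⟨ #compositions-suc k (k + (n + k)) ⟨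
  #compositions k (suc (k + (n + k)))
    ≡⟨ cong (#compositions k) (1+k+[n+k]≡n+2k+1 n k) ⟩
  #compositions k (n + 2 * k + 1)
    ≡⟨ numCompositions≡#compositions k (n + 2 * k + 1) ⟨
  numCompositions k (n + 2 * k + 1) ∎
  where
  open ≡-Reasoning
  1+k+[n+k]≡n+2k+1 : ∀ n k → suc (k + (n + k)) ≡ n + 2 * k + 1
  1+k+[n+k]≡n+2k+1 = solve-∀
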